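{- Let $G$ be a simple graph that is unmixed and has a $\tau$-reduction $G_1,\dots,G_s$. Then for every maximal stable set $F$ of $G$ and every $i$, $\alpha(G_i)=|F\cap V(G_i)|$.
   Context: A stable set is a vertex set containing no edge; $\alpha(H)$ is the maximum size of a stable set of $H$. A vertex cover is a vertex set meeting every edge; $\tau(H)$ is the minimum size of a vertex cover. $G$ is unmixed if every minimal vertex cover has $\tau(G)$ elements (equivalently every maximal stable set has $\alpha(G)$ elements). A $\tau$-reduction of $G$ is a family of induced subgraphs $G_1,\dots,G_s$ whose vertex sets partition $V(G)$ and with $\tau(G)=\sum_{i=1}^s\tau(G_i)$. -}

module Defs where

open import Data.Nat using (ℕ; _≤_)
open import Data.Fin using (Fin)
open import Data.Fin.Subset using (Subset; _∈_; _⊆_; ∣_∣; ⊤)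
open import Data.Product using (Σ; _×_; ∃)
open import Data.Sum using (_⊎_)
open import Data.Vec.Functional using (Vector)
open import Relation.Binary.PropositionalEquality using (_≡_)
open import Relation.Nullary using (¬_)

record SimpleGraph (n : ℕ) : Set₁ where
  field
    Adj     : Fin n → Fin n → Set
    sym     : ∀ {u v} → Adj u v → Adj v u
    irrefl  : ∀ {u} → ¬ Adj u u
open SimpleGraph public

-- Everything below concerns the induced subgraph G[W] for a vertex set W ⊆ V(G).
-- (G itself is G[⊤].)

IsStable : ∀ {n} → SimpleGraph n → Subset n → Subset n → Set
IsStable G W S = S ⊆ W × (∀ {u v} → u ∈ S → v ∈ S → ¬ Adj G u v)

IsCover : ∀ {n} → SimpleGraph n → Subset n → Subset n → Set
IsCover G W C = C ⊆ W × (∀ {u v} → u ∈ W → v ∈ W → Adj G u v → u ∈ C ⊎ v ∈ C)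

IsAlpha : ∀ {n} → SimpleGraph n → Subset n → ℕ → Set
IsAlpha G W k = (∃ λ S → IsStable G W S × ∣ S ∣ ≡ k)
              × (∀ S → IsStable G W S → ∣ S ∣ ≤ k)

IsTau : ∀ {n} → SimpleGraph n → Subset n → ℕ → Set
IsTau G W k = (∃ λ C → IsCover G W C × ∣ C ∣ ≡ k)
            × (∀ C → IsCover G W C → k ≤ ∣ C ∣)

IsMaximalStable : ∀ {n} → SimpleGraph n → Subset n → Set
IsMaximalStable G F = IsStable G ⊤ F × (∀ S → IsStable G ⊤ S → F ⊆ S → S ≡ F)

IsMinimalCover : ∀ {n} → SimpleGraph n → Subset n → Set
IsMinimalCover G C = IsCover G ⊤ C × (∀ D → IsCover G ⊤ D → D ⊆ C → D ≡ C)

Unmixed : ∀ {n} → SimpleGraph n → Set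
Unmixed G = ∀ t → IsTau G ⊤ t → ∀ C → IsMinimalCover G C → ∣ C ∣ ≡ t

IsPartition : ∀ {n s} → Vector (Subset n) s → Set
IsPartition {n} V = (∀ (v : Fin n) → ∃ λ i → v ∈ V i)
                  × (∀ {i j} {v : Fin n} → v ∈ V i → v ∈ V j → i ≡ j)

Σᶠ : ∀ {s} → Vector ℕ s → ℕ
Σᶠ = Data.Vec.Functional.foldr Data.Nat._+_ 0
  where import Data.Nat

-- Complementation turns maximal stable sets into minimal vertex covers, so by
-- unmixedness ∁F is a minimum cover: ∣∁F∣ = τ(G) = Σ τ(Gᵢ). Its traces ∁F ∩ V(Gᵢ)
-- cover the Gᵢ, so each has at least τ(Gᵢ) elements; as the traces add up to ∣∁F∣,
-- each has exactly τ(Gᵢ). Finally any stable set S of Gᵢ leaves a cover ∁S ∩ V(Gᵢ),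
-- so ∣S∣ + τ(Gᵢ) ≤ ∣V(Gᵢ)∣ = ∣F ∩ V(Gᵢ)∣ + τ(Gᵢ).
module Submission where

open import Defs
open import Data.Bool using (Bool; true; false; _∧_)
open import Data.Bool.Properties using (∧-identityʳ)
open import Data.Empty using (⊥-elim)
open import Data.Fin using (Fin; zero; suc; punchIn)
open import Data.Fin.Properties using (punchInᵢ≢i)
open import Data.Fin.Subset using (Subset; ⊤; _∩_; ∣_∣; ∁; _∈_; _∉_)
open import Data.Fin.Subset.Properties
open import Data.Nat using (ℕ; zero; suc; _+_; _≤_; z≤n)
open import Data.Nat.Properties
-- This sum is definitionally Σᶠ.
open import Algebra.Properties.CommutativeMonoid.Sum +-0-commutativeMonoid
  using (sum; ∑-comm; sum-cong-≗; sum-remove; sum-replicate-zero)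
open import Data.Product using (_,_; proj₁; proj₂)
open import Data.Sum using (_⊎_; inj₁; inj₂; [_,_])
open import Data.Vec using (_∷_; []; lookup)
open import Data.Vec.Functional using (Vector)
open import Data.Vec.Properties using (lookup-zipWith; []=⇒lookup; lookup⇒[]=)
open import Function using (_∘_)
open import Relation.Binary.PropositionalEquality as ≡
  using (_≡_; _≢_; refl; trans; cong; subst; module ≡-Reasoning)
open import Relation.Nullary using (yes; no)

private
  variable
    n s : ℕ

∑-mono-≤ : (a b : Vector ℕ s) → (∀ i → a i ≤ b i) → sum a ≤ sum b
∑-mono-≤ {zero}  a b a≤b = z≤n
∑-mono-≤ {suc s} a b a≤b = +-mono-≤ (a≤b zero) (∑-mono-≤ (a ∘ suc) (b ∘ suc) (a≤b ∘ suc))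

≤-∑-≡⇒≡ : (a b : Vector ℕ s) → (∀ i → a i ≤ b i) → sum b ≡ sum a → ∀ i → b i ≡ a i
≤-∑-≡⇒≡ {suc s} a b a≤b ∑b≡∑a = pointwise
  where
  ∑a≤∑b : sum (a ∘ suc) ≤ sum (b ∘ suc)
  ∑a≤∑b = ∑-mono-≤ (a ∘ suc) (b ∘ suc) (a≤b ∘ suc)
  head≡ : b zero ≡ a zero
  head≡ = ≤-antisym
    (+-cancelʳ-≤ (sum (b ∘ suc)) (b zero) (a zero)
      (≤-trans (≤-reflexive ∑b≡∑a) (+-monoʳ-≤ (a zero) ∑a≤∑b)))
    (a≤b zero)
  tail≡ : sum (b ∘ suc) ≡ sum (a ∘ suc)
  tail≡ = +-cancelˡ-≡ (a zero) _ _ (trans (cong (_+ sum (b ∘ suc)) (≡.sym head≡)) ∑b≡∑a)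
  pointwise : ∀ i → b i ≡ a i
  pointwise zero    = head≡
  pointwise (suc i) = ≤-∑-≡⇒≡ (a ∘ suc) (b ∘ suc) (a≤b ∘ suc) tail≡ i

∑-supported : (t : Vector ℕ s) (i : Fin s) → (∀ j → j ≢ i → t j ≡ 0) → sum t ≡ t i
∑-supported {suc s} t i zero-off = begin
  sum t                               ≡⟨ sum-remove t ⟩
  t i + sum (t ∘ punchIn i)           ≡⟨ cong (t i +_) (sum-cong-≗ (λ j → zero-off _ (punchInᵢ≢i i j))) ⟩
  t i + sum {s} (λ _ → 0)             ≡⟨ cong (t i +_) (sum-replicate-zero s) ⟩
  t i + 0                             ≡⟨ +-identityʳ (t i) ⟩
  t i                                 ∎
  where open ≡-Reasoning

indicator : Bool → ℕ
indicator true  = 1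
indicator false = 0

∣p∣≡∑indicator : (p : Subset n) → ∣ p ∣ ≡ sum (λ v → indicator (lookup p v))
∣p∣≡∑indicator []          = refl
∣p∣≡∑indicator (true ∷ p)  = cong suc (∣p∣≡∑indicator p)
∣p∣≡∑indicator (false ∷ p) = ∣p∣≡∑indicator p

x∉p⇒indicator≡0 : {x : Fin n} {p : Subset n} → x ∉ p → indicator (lookup p x) ≡ 0
x∉p⇒indicator≡0 {x = x} {p} x∉p with lookup p x in eq
... | true  = ⊥-elim (x∉p (lookup⇒[]= x p eq))
... | false = refl

lookup-∩-∈ : {x : Fin n} (p q : Subset n) → x ∈ q → lookup (p ∩ q) x ≡ lookup p x
lookup-∩-∈ {x = x} p q x∈q = begin
  lookup (p ∩ q) x            ≡⟨ lookup-zipWith _∧_ x p q ⟩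
  lookup p x ∧ lookup q x     ≡⟨ cong (lookup p x ∧_) ([]=⇒lookup x∈q) ⟩
  lookup p x ∧ true           ≡⟨ ∧-identityʳ (lookup p x) ⟩
  lookup p x                  ∎
  where open ≡-Reasoning

∑∣X∩V∣≡∣X∣ : (V : Vector (Subset n) s) → IsPartition V → (X : Subset n) →
             sum (λ i → ∣ X ∩ V i ∣) ≡ ∣ X ∣
∑∣X∩V∣≡∣X∣ V (covered , disjoint) X = begin
  sum (λ i → ∣ X ∩ V i ∣)                                 ≡⟨ sum-cong-≗ (λ i → ∣p∣≡∑indicator (X ∩ V i)) ⟩
  sum (λ i → sum (λ v → indicator (lookup (X ∩ V i) v)))  ≡⟨ ∑-comm (λ i v → indicator (lookup (X ∩ V i) v)) ⟩
  sum (λ v → sum (λ i → indicator (lookup (X ∩ V i) v)))  ≡⟨ sum-cong-≗ countOnce ⟩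
  sum (λ v → indicator (lookup X v))                      ≡⟨ ≡.sym (∣p∣≡∑indicator X) ⟩
  ∣ X ∣                                                   ∎
  where
  open ≡-Reasoning
  countOnce : ∀ v → sum (λ i → indicator (lookup (X ∩ V i) v)) ≡ indicator (lookup X v)
  countOnce v with covered v
  ... | i , v∈Vᵢ = trans
    (∑-supported _ i (λ j j≢i → x∉p⇒indicator≡0 (λ v∈ → j≢i (disjoint (proj₂ (x∈p∩q⁻ X (V j) v∈)) v∈Vᵢ))))
    (cong indicator (lookup-∩-∈ X (V i) v∈Vᵢ))

∣p∩q∣+∣∁p∩q∣≡∣q∣ : (p q : Subset n) → ∣ p ∩ q ∣ + ∣ ∁ p ∩ q ∣ ≡ ∣ q ∣
∣p∩q∣+∣∁p∩q∣≡∣q∣ []          []          = refl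
∣p∩q∣+∣∁p∩q∣≡∣q∣ (true ∷ p)  (true ∷ q)  = cong suc (∣p∩q∣+∣∁p∩q∣≡∣q∣ p q)
∣p∩q∣+∣∁p∩q∣≡∣q∣ (false ∷ p) (true ∷ q)  =
  trans (+-suc ∣ p ∩ q ∣ ∣ ∁ p ∩ q ∣) (cong suc (∣p∩q∣+∣∁p∩q∣≡∣q∣ p q))
∣p∩q∣+∣∁p∩q∣≡∣q∣ (true ∷ p)  (false ∷ q) = ∣p∩q∣+∣∁p∩q∣≡∣q∣ p q
∣p∩q∣+∣∁p∩q∣≡∣q∣ (false ∷ p) (false ∷ q) = ∣p∩q∣+∣∁p∩q∣≡∣q∣ p q

module _ (G : SimpleGraph n) where

  cover-∩ : {C : Subset n} (W : Subset n) → IsCover G ⊤ C → IsCover G W (C ∩ W)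
  cover-∩ {C} W (_ , covers) = p∩q⊆q C W , λ u∈W v∈W uv →
    [ (λ u∈C → inj₁ (x∈p∩q⁺ (u∈C , u∈W))) , (λ v∈C → inj₂ (x∈p∩q⁺ (v∈C , v∈W))) ]
      (covers ∈⊤ ∈⊤ uv)

  stable⇒∁-cover : {W S : Subset n} → IsStable G W S → IsCover G ⊤ (∁ S)
  stable⇒∁-cover {S = S} (_ , stable) = (λ _ → ∈⊤) , cover
    where
    cover : ∀ {u v} → u ∈ ⊤ → v ∈ ⊤ → Adj G u v → u ∈ ∁ S ⊎ v ∈ ∁ S
    cover {u} {v} _ _ uv with u ∈? S | v ∈? S
    ... | no u∉S  | _       = inj₁ (x∉p⇒x∈∁p u∉S)
    ... | yes _   | no v∉S  = inj₂ (x∉p⇒x∈∁p v∉S)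
    ... | yes u∈S | yes v∈S = ⊥-elim (stable u∈S v∈S uv)

  cover⇒∁-stable : {C : Subset n} → IsCover G ⊤ C → IsStable G ⊤ (∁ C)
  cover⇒∁-stable (_ , covers) = (λ _ → ∈⊤) , λ u∈ v∈ uv →
    [ x∈∁p⇒x∉p u∈ , x∈∁p⇒x∉p v∈ ] (covers ∈⊤ ∈⊤ uv)

  maximalStable⇒∁-minimalCover : {F : Subset n} → IsMaximalStable G F → IsMinimalCover G (∁ F)
  maximalStable⇒∁-minimalCover {F} (F-stable , F-maximal) =
    stable⇒∁-cover F-stable , λ D D-cover D⊆∁F →
      let ∁D≡F = F-maximal (∁ D) (cover⇒∁-stable D-cover)
                   (λ x∈F → x∉p⇒x∈∁p (x∈p⇒x∉∁p x∈F ∘ D⊆∁F))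
      in ⊆-antisym D⊆∁F (λ x∈∁F → x∉∁p⇒x∈p (x∈∁p⇒x∉p x∈∁F ∘ subst (_ ∈_) ∁D≡F))

  stable+τ≤∣W∣ : {W S : Subset n} {t : ℕ} → IsTau G W t → IsStable G W S → ∣ S ∣ + t ≤ ∣ W ∣
  stable+τ≤∣W∣ {W} {S} {t} (_ , minimum) S-stable@(S⊆W , _) = begin
    ∣ S ∣ + t                     ≤⟨ +-mono-≤ (p⊆q⇒∣p∣≤∣q∣ (λ x∈S → x∈p∩q⁺ (x∈S , S⊆W x∈S)))
                                              (minimum _ (cover-∩ W (stable⇒∁-cover S-stable))) ⟩
    ∣ S ∩ W ∣ + ∣ ∁ S ∩ W ∣       ≡⟨ ∣p∩q∣+∣∁p∩q∣≡∣q∣ S W ⟩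
    ∣ W ∣                         ∎
    where open ≤-Reasoning

  ∁-minimumCover⇒α : {W F : Subset n} → IsStable G ⊤ F → IsTau G W ∣ ∁ F ∩ W ∣ →
                     IsAlpha G W ∣ F ∩ W ∣
  ∁-minimumCover⇒α {W} {F} (_ , F-stable) τ =
    (F ∩ W , (p∩q⊆q F W , λ u∈ v∈ → F-stable (p∩q⊆p F W u∈) (p∩q⊆p F W v∈)) , refl) ,
    λ S S-stable → +-cancelʳ-≤ _ _ _
      (≤-trans (stable+τ≤∣W∣ τ S-stable) (≤-reflexive (≡.sym (∣p∩q∣+∣∁p∩q∣≡∣q∣ F W))))

lemma2p1 : ∀ {n s} (G : SimpleGraph n) → Unmixed G →
           (V : Vector (Subset n) s) → IsPartition V →
           (t : Vector ℕ s) → (∀ i → IsTau G (V i) (t i)) → IsTau G ⊤ (Σᶠ t) →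
           ∀ F → IsMaximalStable G F → ∀ (i : Fin s) → IsAlpha G (V i) ∣ F ∩ V i ∣
lemma2p1 G unmixed V partition t τᵢ τ F F-maximal i =
  ∁-minimumCover⇒α G (proj₁ F-maximal) (subst (IsTau G (V i)) (≡.sym (∣∁F∩Vⱼ∣≡tⱼ i)) (τᵢ i))
  where
  ∁F-minimal : IsMinimalCover G (∁ F)
  ∁F-minimal = maximalStable⇒∁-minimalCover G F-maximal
  ∣∁F∣≡τ : ∣ ∁ F ∣ ≡ Σᶠ t
  ∣∁F∣≡τ = unmixed (Σᶠ t) τ (∁ F) ∁F-minimal
  ∣∁F∩Vⱼ∣≡tⱼ : ∀ j → ∣ ∁ F ∩ V j ∣ ≡ t j
  ∣∁F∩Vⱼ∣≡tⱼ = ≤-∑-≡⇒≡ t (λ j → ∣ ∁ F ∩ V j ∣)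
    (λ j → proj₂ (τᵢ j) _ (cover-∩ G (V j) (proj₁ ∁F-minimal)))
    (trans (∑∣X∩V∣≡∣X∣ V partition (∁ F)) ∣∁F∣≡τ)
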